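{- Let $S_n$ be the star of order $n\ge 3$. Then $\Delta_{S_n}=\lfloor n/2\rfloor$.
   Context: The star $S_n$ is the tree on $n$ vertices with one vertex adjacent to all other $n-1$ vertices. A $\Delta$-completion set of a graph $G$ is a set $F$ of non-edges of $G$ such that every vertex of $G+F$ lies in a triangle; $\Delta_G$ is the minimum size of such a set. -}

module Defs where

open import Data.Nat using (ℕ; _≤_; _<_)
open import Data.Fin using (Fin; toℕ)
open import Data.Product using (_×_; Σ; ∃; ∃-syntax; _,_)
open import Data.Sum using (_⊎_)
open import Data.List using (List; length)
open import Data.List.Membership.Propositional using (_∈_)
open import Data.List.Relation.Unary.All using (All)
open import Data.List.Relation.Unary.Unique.Propositional using (Unique)
open import Relation.Binary.PropositionalEquality using (_≡_; _≢_)
open import Relation.Nullary using (¬_)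

record Graph (n : ℕ) : Set₁ where
  field
    Adj   : Fin n → Fin n → Set
    sym   : ∀ {i j} → Adj i j → Adj j i
    irrefl : ∀ {i} → ¬ Adj i i
open Graph public

StarAdj : {n : ℕ} → Fin n → Fin n → Set
StarAdj i j = (toℕ i ≡ 0 × toℕ j ≢ 0) ⊎ (toℕ j ≡ 0 × toℕ i ≢ 0)

Star : (n : ℕ) → Graph n
Star n = record
  { Adj = StarAdj
  ; sym = λ { (Data.Sum.inj₁ (a , b)) → Data.Sum.inj₂ (a , b)
            ; (Data.Sum.inj₂ (a , b)) → Data.Sum.inj₁ (a , b) }
  ; irrefl = λ { (Data.Sum.inj₁ (a , b)) → b a
               ; (Data.Sum.inj₂ (a , b)) → b a } }

-- A set of non-edges is a duplicate-free list of pairs (i , j) with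
-- toℕ i < toℕ j (so each unordered pair {i,j}, i ≠ j, is represented once),
-- none of which is an edge of G.
IsNonEdgeSet : {n : ℕ} → Graph n → List (Fin n × Fin n) → Set
IsNonEdgeSet G F =
  Unique F × All (λ { (i , j) → (toℕ i < toℕ j) × ¬ Adj G i j }) F

AdjPlus : {n : ℕ} → Graph n → List (Fin n × Fin n) → Fin n → Fin n → Set
AdjPlus G F i j = Adj G i j ⊎ ((i , j) ∈ F) ⊎ ((j , i) ∈ F)

InTriangle : {n : ℕ} → Graph n → List (Fin n × Fin n) → Fin n → Set
InTriangle G F v = ∃[ a ] ∃[ b ]
  (v ≢ a × v ≢ b × a ≢ b ×
   AdjPlus G F v a × AdjPlus G F v b × AdjPlus G F a b)

IsΔCompletion : {n : ℕ} → Graph n → List (Fin n × Fin n) → Set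
IsΔCompletion G F = IsNonEdgeSet G F × (∀ v → InTriangle G F v)

ΔNumberIs : {n : ℕ} → Graph n → ℕ → Set
ΔNumberIs G m =
  (∃[ F ] (IsΔCompletion G F × length F ≡ m)) ×
  (∀ F → IsΔCompletion G F → m ≤ length F)

-- A leaf of the star has the centre as its only neighbour, so a triangle
-- through it must use an added edge; hence every one of the n - 1 leaves is
-- an endpoint of a completion set F, and n - 1 ≤ 2 |F|.  Conversely, pairing
-- up the leaves (with one leaf used twice when their number is odd) gives a
-- completion set of size ⌊n/2⌋: each added edge closes a triangle with the
-- centre.
module Submission where

open import Defs hiding (sym)
open import Data.Nat using (ℕ; zero; suc; _+_; _≤_; _<_; _*_; _/_; z≤n; s≤s; s≤s⁻¹)
open import Data.Nat.Properties using (<-irrefl)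
open import Data.Nat.DivMod using (m<n*o⇒m/o<n; m/n≡1+[m∸n]/n)
open import Data.Fin using (Fin; toℕ) renaming (zero to fzero; suc to fsuc)
open import Data.Fin.Properties using (injective⇒≤; suc-injective)
open import Data.Product using (_×_; ∃-syntax; _,_)
import Data.Product as Product
open import Data.Sum using (_⊎_; inj₁; inj₂)
open import Data.List using (List; []; _∷_; length; map; lookup)
open import Data.List.Properties using (length-map)
open import Data.List.Membership.Propositional using (_∈_)
open import Data.List.Membership.Propositional.Properties using (∈-map⁺)
open import Data.List.Relation.Unary.Any using (here; there; index)
open import Data.List.Relation.Unary.Any.Properties using (lookup-index)
open import Data.List.Relation.Unary.All as All using (All; []; _∷_)
import Data.List.Relation.Unary.All.Properties as All
open import Data.List.Relation.Unary.AllPairs using ([]; _∷_)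
open import Data.List.Relation.Unary.Unique.Propositional using (Unique)
import Data.List.Relation.Unary.Unique.Propositional.Properties as Unique
open import Data.Empty using (⊥-elim)
open import Function.Base using (_∘_)
open import Function.Definitions using (Injective)
open import Relation.Binary.PropositionalEquality
  using (_≡_; _≢_; refl; sym; trans; cong; subst; module ≡-Reasoning)
open import Relation.Nullary using (¬_)

private
  variable
    A B : Set
    m n : ℕ

endpoints : List (A × A) → List A
endpoints []             = []
endpoints ((a , b) ∷ ps) = a ∷ b ∷ endpoints ps

length-endpoints : (ps : List (A × A)) → length (endpoints ps) ≡ length ps * 2
length-endpoints []       = refl
length-endpoints (_ ∷ ps) = cong (λ k → suc (suc k)) (length-endpoints ps)

∈-endpoints-fst : ∀ {ps : List (A × A)} {a b} → (a , b) ∈ ps → a ∈ endpoints ps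
∈-endpoints-fst (here refl) = here refl
∈-endpoints-fst (there p)   = there (there (∈-endpoints-fst p))

∈-endpoints-snd : ∀ {ps : List (A × A)} {a b} → (a , b) ∈ ps → b ∈ endpoints ps
∈-endpoints-snd (here refl) = there (here refl)
∈-endpoints-snd (there p)   = there (there (∈-endpoints-snd p))

∈-endpoints⁻ : ∀ {ps : List (A × A)} {a} → a ∈ endpoints ps →
               ∃[ b ] ((a , b) ∈ ps ⊎ (b , a) ∈ ps)
∈-endpoints⁻ {ps = (_ , b) ∷ _} (here refl)         = b , inj₁ (here refl)
∈-endpoints⁻ {ps = (a , _) ∷ _} (there (here refl)) = a , inj₂ (here refl)
∈-endpoints⁻ {ps = _ ∷ _}       (there (there p))   with ∈-endpoints⁻ p
... | b , inj₁ q = b , inj₁ (there q)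
... | b , inj₂ q = b , inj₂ (there q)

∈-endpoints-map : ∀ (f : A → B) {ps a} → a ∈ endpoints ps →
                  f a ∈ endpoints (map (Product.map f f) ps)
∈-endpoints-map f {_ ∷ _} (here refl)         = here refl
∈-endpoints-map f {_ ∷ _} (there (here refl)) = there (here refl)
∈-endpoints-map f {_ ∷ _} (there (there p))   = there (there (∈-endpoints-map f p))

injective-members⇒≤-length : ∀ {f : Fin m → A} {xs} → Injective _≡_ _≡_ f →
                             (∀ i → f i ∈ xs) → m ≤ length xs
injective-members⇒≤-length {f = f} {xs} f-injective f∈xs =
  injective⇒≤ λ {i} {j} same-index → f-injective (same-position i same-index)
  where
  same-position : ∀ i {j} → index (f∈xs i) ≡ index (f∈xs j) → f i ≡ f j
  same-position i {j} same-index =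
    trans (lookup-index (f∈xs i))
          (trans (cong (lookup xs) same-index) (sym (lookup-index (f∈xs j))))

adjPlus⇒adj⊎endpoint : ∀ (G : Graph n) F {v w} → AdjPlus G F v w →
                       Adj G v w ⊎ v ∈ endpoints F
adjPlus⇒adj⊎endpoint G F (inj₁ vw)        = inj₁ vw
adjPlus⇒adj⊎endpoint G F (inj₂ (inj₁ vw)) = inj₂ (∈-endpoints-fst vw)
adjPlus⇒adj⊎endpoint G F (inj₂ (inj₂ wv)) = inj₂ (∈-endpoints-snd wv)

pendant-inTriangle⇒endpoint : ∀ (G : Graph n) F {v c} →
                              (∀ {w} → Adj G v w → w ≡ c) →
                              InTriangle G F v → v ∈ endpoints F
pendant-inTriangle⇒endpoint G F pendant (a , b , _ , _ , a≢b , va , vb , _)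
  with adjPlus⇒adj⊎endpoint G F va | adjPlus⇒adj⊎endpoint G F vb
... | inj₂ v∈F | _        = v∈F
... | inj₁ _   | inj₂ v∈F = v∈F
... | inj₁ Gva | inj₁ Gvb = ⊥-elim (a≢b (trans (pendant Gva) (sym (pendant Gvb))))

star-leaf-neighbour : ∀ {i : Fin m} {w} → StarAdj (fsuc i) w → w ≡ fzero
star-leaf-neighbour {w = fzero} _                 = refl
star-leaf-neighbour {w = fsuc _} (inj₁ (() , _))
star-leaf-neighbour {w = fsuc _} (inj₂ (() , _))

star-leaves-nonadjacent : ∀ {i j : Fin m} → ¬ StarAdj (fsuc i) (fsuc j)
star-leaves-nonadjacent (inj₁ (() , _))
star-leaves-nonadjacent (inj₂ (() , _))

ΔCompletion-Star⇒n/2≤length : ∀ {F} → IsΔCompletion (Star (suc m)) F → suc m / 2 ≤ length F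
ΔCompletion-Star⇒n/2≤length {m} {F} (_ , inTriangle) =
  s≤s⁻¹ (m<n*o⇒m/o<n {n = suc (length F)} (s≤s (s≤s leaves≤)))
  where
  leaf∈F : (i : Fin m) → fsuc i ∈ endpoints F
  leaf∈F i = pendant-inTriangle⇒endpoint (Star (suc m)) F star-leaf-neighbour
               (inTriangle (fsuc i))

  leaves≤ : m ≤ length F * 2
  leaves≤ = subst (m ≤_) (length-endpoints F)
              (injective-members⇒≤-length suc-injective leaf∈F)

Ordered : List (Fin m × Fin m) → Set
Ordered = All (λ (i , j) → toℕ i < toℕ j)

sucPair : Fin m × Fin m → Fin (suc m) × Fin (suc m)
sucPair = Product.map fsuc fsuc

sucPair-injective : ∀ {p q : Fin m × Fin m} → sucPair p ≡ sucPair q → p ≡ q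
sucPair-injective {p = _ , _} {q = _ , _} refl = refl

ordered-sucPair : ∀ {P : List (Fin m × Fin m)} → Ordered P → Ordered (map sucPair P)
ordered-sucPair ordered = All.map⁺ (All.map s≤s ordered)

-- Every pair {i, j} of P closes the triangle {0, i+1, j+1} of the star.
leafCover⇒ΔCompletion-Star : ∀ {P : List (Fin (suc m) × Fin (suc m))} →
  Unique P → Ordered P → (∀ i → i ∈ endpoints P) →
  IsΔCompletion (Star (suc (suc m))) (map sucPair P)
leafCover⇒ΔCompletion-Star {m} {P} unique ordered covers =
  (Unique.map⁺ sucPair-injective unique ,
   All.map⁺ (All.map (λ i<j → s≤s i<j , star-leaves-nonadjacent) ordered)) ,
  inTriangle
  where
  S : Graph (suc (suc m))
  S = Star (suc (suc m))

  F : List (Fin (suc (suc m)) × Fin (suc (suc m)))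
  F = map sucPair P

  distinct : ∀ {i j} → (i , j) ∈ P → fsuc i ≢ fsuc j
  distinct ij refl = <-irrefl refl (All.lookup ordered ij)

  centre : ∀ {i j} → (i , j) ∈ P → InTriangle S F fzero
  centre ij = _ , _ , (λ ()) , (λ ()) , distinct ij ,
              inj₁ (inj₁ (refl , λ ())) , inj₁ (inj₁ (refl , λ ())) ,
              inj₂ (inj₁ (∈-map⁺ sucPair ij))

  first : ∀ {i j} → (i , j) ∈ P → InTriangle S F (fsuc i)
  first ij = _ , _ , (λ ()) , distinct ij , (λ ()) ,
             inj₁ (inj₂ (refl , λ ())) , inj₂ (inj₁ (∈-map⁺ sucPair ij)) ,
             inj₁ (inj₁ (refl , λ ()))

  second : ∀ {i j} → (i , j) ∈ P → InTriangle S F (fsuc j)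
  second ij = _ , _ , (λ ()) , distinct ij ∘ sym , (λ ()) ,
              inj₁ (inj₂ (refl , λ ())) , inj₂ (inj₂ (∈-map⁺ sucPair ij)) ,
              inj₁ (inj₁ (refl , λ ()))

  inTriangle : ∀ v → InTriangle S F v
  inTriangle fzero with ∈-endpoints⁻ (covers fzero)
  ... | _ , inj₁ ij = centre ij
  ... | _ , inj₂ ji = centre ji
  inTriangle (fsuc i) with ∈-endpoints⁻ (covers i)
  ... | _ , inj₁ ij = first ij
  ... | _ , inj₂ ji = second ji

-- The leaves 0 … t+1 paired as (0,1), (2,3), …; when their number is odd
-- the last two pairs are (t-1,t), (t,t+1).
leafPairing : (t : ℕ) → List (Fin (2 + t) × Fin (2 + t))
leafPairing zero          = (fzero , fsuc fzero) ∷ []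
leafPairing (suc zero)    = (fzero , fsuc fzero) ∷ (fsuc fzero , fsuc (fsuc fzero)) ∷ []
leafPairing (suc (suc t)) = (fzero , fsuc fzero) ∷ map sucPair (map sucPair (leafPairing t))

leafPairing-unique : ∀ t → Unique (leafPairing t)
leafPairing-unique zero          = [] ∷ []
leafPairing-unique (suc zero)    = ((λ ()) ∷ []) ∷ [] ∷ []
leafPairing-unique (suc (suc t)) =
  All.map⁺ (All.map⁺ (All.universal (λ _ ()) (leafPairing t))) ∷
  Unique.map⁺ sucPair-injective (Unique.map⁺ sucPair-injective (leafPairing-unique t))

leafPairing-ordered : ∀ t → Ordered (leafPairing t)
leafPairing-ordered zero          = s≤s z≤n ∷ []
leafPairing-ordered (suc zero)    = s≤s z≤n ∷ s≤s (s≤s z≤n) ∷ []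
leafPairing-ordered (suc (suc t)) =
  s≤s z≤n ∷ ordered-sucPair (ordered-sucPair (leafPairing-ordered t))

leafPairing-covers : ∀ t i → i ∈ endpoints (leafPairing t)
leafPairing-covers zero          fzero               = here refl
leafPairing-covers zero          (fsuc fzero)        = there (here refl)
leafPairing-covers (suc zero)    fzero               = here refl
leafPairing-covers (suc zero)    (fsuc fzero)        = there (here refl)
leafPairing-covers (suc zero)    (fsuc (fsuc fzero)) = there (there (there (here refl)))
leafPairing-covers (suc (suc t)) fzero               = here refl
leafPairing-covers (suc (suc t)) (fsuc fzero)        = there (here refl)
leafPairing-covers (suc (suc t)) (fsuc (fsuc i))     =
  there (there (∈-endpoints-map fsuc (∈-endpoints-map fsuc (leafPairing-covers t i))))

length-leafPairing : ∀ t → length (leafPairing t) ≡ (3 + t) / 2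
length-leafPairing zero          = refl
length-leafPairing (suc zero)    = refl
length-leafPairing (suc (suc t)) = begin
  suc (length (map sucPair (map sucPair (leafPairing t))))
    ≡⟨ cong suc (trans (length-map sucPair (map sucPair (leafPairing t)))
                           (length-map sucPair (leafPairing t))) ⟩
  suc (length (leafPairing t))
    ≡⟨ cong suc (length-leafPairing t) ⟩
  suc ((3 + t) / 2)
    ≡⟨ sym (m/n≡1+[m∸n]/n {5 + t} {2} (s≤s (s≤s z≤n))) ⟩
  (5 + t) / 2 ∎
  where open ≡-Reasoning

proposition6p1 : (n : ℕ) → 3 ≤ n → ΔNumberIs (Star n) (n / 2)
proposition6p1 (suc (suc (suc t))) (s≤s (s≤s (s≤s _))) =
  (map sucPair (leafPairing t) ,
   leafCover⇒ΔCompletion-Star (leafPairing-unique t) (leafPairing-ordered t)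
                              (leafPairing-covers t) ,
   trans (length-map sucPair (leafPairing t)) (length-leafPairing t)) ,
  λ _ → ΔCompletion-Star⇒n/2≤length
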